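{- Let $a$ and $b$ be positive integers. Then $S(n)=F_{an+b}$ is not an LP function, and $S(n)=L_{an+b}$ is not an LP function.
   Context: $F_n$ is the Fibonacci sequence ($F_0=0$, $F_1=1$, $F_n=F_{n-1}+F_{n-2}$) and $L_n$ the Lucas numbers ($L_0=2$, $L_1=1$, $L_n=L_{n-1}+L_{n-2}$). An arithmetic function $S$ is an LP function (has the Lucas property) if for every prime $p$ and every nonnegative integer $n=\sum_{i=0}^{r}n_i p^i$ with base-$p$ digits $0\le n_i\le p-1$, one has $S(n)\equiv S(n_0)S(n_1)\cdots S(n_r)\pmod p$. -}

module Defs where

open import Data.Nat using (ℕ; zero; suc; _+_; _*_; _%_; _/_; NonZero)
open import Data.Nat.Primality using (Prime)
open import Data.List using (List; []; _∷_; map)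
open import Data.Nat.ListAction using (product)
open import Relation.Binary.PropositionalEquality using (_≡_)

fib : ℕ → ℕ
fib zero = 0
fib (suc zero) = 1
fib (suc (suc n)) = fib (suc n) + fib n

lucas : ℕ → ℕ
lucas zero = 2
lucas (suc zero) = 1
lucas (suc (suc n)) = lucas (suc n) + lucas n

-- base-p digits of n, least significant first, with a fuel argument
-- (fuel ≥ n suffices since n / p < n for n > 0, p ≥ 2).
-- digits of 0 is the single digit [0].
digitsAux : (p : ℕ) → .{{NonZero p}} → ℕ → ℕ → List ℕ
digitsAux p zero n = n % p ∷ []
digitsAux p (suc fuel) n with n / p
... | zero = n % p ∷ []
... | suc q = n % p ∷ digitsAux p fuel (suc q)

digits : (p : ℕ) → .{{NonZero p}} → ℕ → List ℕ
digits p n = digitsAux p n n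

IsLP : (ℕ → ℕ) → Set
IsLP S = ∀ (p : ℕ) (pr : Prime p) (n : ℕ) →
  let instance _ = nz pr in
  S n % p ≡ product (map S (digits p n)) % p
  where
    nz : ∀ {p} → Prime p → NonZero p
    nz {suc p} _ = _
    nz {zero} ()

-- Suppose S n = G (A n + B) has the Lucas property, where A = a + 1 and G is Fibonacci-like.
-- For a prime p with p + k written as the digits k, 1 (k = 0, 1), it gives S (p + k) ≡ S k · c
-- (mod p) with c = S 1.  By the addition formula G (X + m + 1) = F (X + 1) G (m + 1) + F X G m at
-- X = A p, the consecutive pairs (G (m + 1), G m) at m = b and m = a + b + 1 both satisfy the
-- linear relation (F (X + 1) − c) u + F X v ≡ 0.  Their cross product is F (a + 1) times the
-- Cassini quantity G b G (b + 2) − G (b + 1)², which is ± a fixed nonzero constant, so for p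
-- large p ∣ F X and then F (X + 1) ≡ c.  Cassini's identity for F at X now gives c² ± 1 ≡ 0,
-- impossible once p > c² + 1 and c ≥ 2.
module Submission where

open import Defs
open import Data.Nat using (ℕ; suc; _+_; _*_)
open import Data.Product using (_×_)
open import Relation.Nullary using (¬_)

open import Data.Nat using (zero; pred; _≤_; _<_; s≤s; z≤n; NonZero; ≢-nonZero⁻¹; nonTrivial⇒n>1; _%_; _/_; _!; _≤?_)
open import Data.Nat.Properties
  using (+-comm; +-suc; *-comm; suc-injective; _!≢0; +-identityʳ; *-zeroʳ; *-identityʳ; m≤m+n; m≤n+m; n<1+n; pred[n]≤n; ≤-trans; ≤-<-trans; *-mono-<; <-trans; ≰⇒>; +-mono-≤)
open import Data.Nat.DivMod using (m≡m%n+[m/n]*n; m<n⇒m/n≡0; m<n⇒m%n≡m; [m+n]%n≡m%n; +-distrib-/-∣ˡ; n/n≡1)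
open import Data.Nat.Divisibility as ℕ∣ using (divides; m∣m*n; ∣-trans; m≤n⇒m!∣n!; ∣m+n∣m⇒∣n; ∣1⇒≡1; >⇒∤)
open import Data.Nat.Primality using (Prime; prime[2]; euclidsLemma; prime⇒nonTrivial; ¬prime[0]; ¬prime[1])
open import Data.Nat.Primality.Factorisation using (factorise; PrimeFactorisation)
open import Data.Nat.ListAction using (product)
open import Data.List using ([]; _∷_; map)
open import Data.List.Relation.Unary.All using (_∷_)
open import Data.Product using (∃-syntax; _,_)
open import Data.Sum using (_⊎_; inj₁; inj₂)
open import Data.Empty using (⊥-elim)
open import Relation.Nullary using (yes; no)
open import Relation.Binary.PropositionalEquality using (_≡_; refl; sym; trans; cong; cong₂; subst; module ≡-Reasoning)
open import Data.Integer using (ℤ; +_; -[1+_]; ∣_∣)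
  renaming (_+_ to _+ᶻ_; _*_ to _*ᶻ_; _-_ to _-ᶻ_; -_ to -ᶻ_)
open import Data.Integer.Properties using (pos-+; pos-*; abs-*; ∣-i∣≡∣i∣; neg-involutive)
open import Data.Integer.Divisibility.Signed using (divides; ∣⇒∣ᵤ; ∣ᵤ⇒∣; ∣m∣n⇒∣m-n; ∣m+n∣n⇒∣m; ∣n⇒∣m*n; ∣m⇒∣m*n)
  renaming (_∣_ to _∣ᶻ_)
import Data.Nat.Tactic.RingSolver as ℕ-Ring
import Data.Integer.Tactic.RingSolver as ℤ-Ring

record FibonacciLike : Set where
  field
    seq        : ℕ → ℕ
    recurrence : ∀ n → seq (suc (suc n)) ≡ seq (suc n) + seq n

fibonacciSequence : FibonacciLike
fibonacciSequence = record { seq = fib ; recurrence = λ _ → refl }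

lucasSequence : FibonacciLike
lucasSequence = record { seq = lucas ; recurrence = λ _ → refl }

module FibonacciLikeProperties (G : FibonacciLike) where
  open FibonacciLike G

  seq-+ : ∀ k m → seq (k + suc m) ≡ fib (suc k) * seq (suc m) + fib k * seq m
  seq-+ zero    m = sym (trans (+-identityʳ _) (+-identityʳ _))
  seq-+ (suc k) m = begin
    seq (suc k + suc m)                                       ≡⟨ cong seq (sym (+-suc k (suc m))) ⟩
    seq (k + suc (suc m))                                     ≡⟨ seq-+ k (suc m) ⟩
    fib (suc k) * seq (suc (suc m)) + fib k * seq (suc m)     ≡⟨ cong (λ s → fib (suc k) * s + fib k * seq (suc m)) (recurrence m) ⟩
    fib (suc k) * (seq (suc m) + seq m) + fib k * seq (suc m) ≡⟨ regroup (fib (suc k)) (fib k) (seq (suc m)) (seq m) ⟩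
    (fib (suc k) + fib k) * seq (suc m) + fib (suc k) * seq m ∎
    where
    open ≡-Reasoning
    regroup : ∀ f₁ f₀ u v → f₁ * (u + v) + f₀ * u ≡ (f₁ + f₀) * u + f₁ * v
    regroup = ℕ-Ring.solve-∀

  0<seq[1+n] : 0 < seq 1 → ∀ n → 0 < seq (suc n)
  0<seq[1+n] 0<seq[1] zero    = 0<seq[1]
  0<seq[1+n] 0<seq[1] (suc n) = subst (0 <_) (sym (recurrence n)) (≤-trans (0<seq[1+n] 0<seq[1] n) (m≤m+n _ _))

  2≤seq[2+n] : ∀ n → 0 < seq n → 0 < seq (suc n) → 2 ≤ seq (suc (suc n))
  2≤seq[2+n] n 0<seq[n] 0<seq[1+n] = subst (2 ≤_) (sym (recurrence n)) (+-mono-≤ 0<seq[1+n] 0<seq[n])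

  seqᶻ : ℕ → ℤ
  seqᶻ n = + seq n

  recurrenceᶻ : ∀ n → seqᶻ (suc (suc n)) ≡ seqᶻ (suc n) +ᶻ seqᶻ n
  recurrenceᶻ n = trans (cong +_ (recurrence n)) (pos-+ (seq (suc n)) (seq n))

  seqᶻ-+ : ∀ k m → seqᶻ (k + suc m) ≡ + fib (suc k) *ᶻ seqᶻ (suc m) +ᶻ + fib k *ᶻ seqᶻ m
  seqᶻ-+ k m = begin
    + seq (k + suc m)                                        ≡⟨ cong +_ (seq-+ k m) ⟩
    + (fib (suc k) * seq (suc m) + fib k * seq m)            ≡⟨ pos-+ (fib (suc k) * seq (suc m)) (fib k * seq m) ⟩
    + (fib (suc k) * seq (suc m)) +ᶻ + (fib k * seq m)        ≡⟨ cong₂ _+ᶻ_ (pos-* (fib (suc k)) (seq (suc m))) (pos-* (fib k) (seq m)) ⟩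
    + fib (suc k) *ᶻ seqᶻ (suc m) +ᶻ + fib k *ᶻ seqᶻ m ∎
    where open ≡-Reasoning

  cassini : ℕ → ℤ
  cassini n = seqᶻ n *ᶻ seqᶻ (suc (suc n)) -ᶻ seqᶻ (suc n) *ᶻ seqᶻ (suc n)

  cassini-suc : ∀ n → cassini (suc n) ≡ -ᶻ cassini n
  cassini-suc n = alternates (seqᶻ n) (seqᶻ (suc n)) (recurrenceᶻ n) (recurrenceᶻ (suc n))
    where
    identity : ∀ x y → y *ᶻ ((y +ᶻ x) +ᶻ y) -ᶻ (y +ᶻ x) *ᶻ (y +ᶻ x) ≡ -ᶻ (x *ᶻ (y +ᶻ x) -ᶻ y *ᶻ y)
    identity = ℤ-Ring.solve-∀
    alternates : ∀ x y {z w} → z ≡ y +ᶻ x → w ≡ z +ᶻ y → y *ᶻ w -ᶻ z *ᶻ z ≡ -ᶻ (x *ᶻ z -ᶻ y *ᶻ y)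
    alternates x y refl refl = identity x y

  cassini-± : ∀ n → cassini n ≡ cassini 0 ⊎ cassini n ≡ -ᶻ cassini 0
  cassini-± zero    = inj₁ refl
  cassini-± (suc n) with cassini-± n
  ... | inj₁ eq = inj₂ (trans (cassini-suc n) (cong -ᶻ_ eq))
  ... | inj₂ eq = inj₁ (trans (cassini-suc n) (trans (cong -ᶻ_ eq) (neg-involutive (cassini 0))))

  ∣cassini∣ : ∀ n → ∣ cassini n ∣ ≡ ∣ cassini 0 ∣
  ∣cassini∣ n with cassini-± n
  ... | inj₁ eq = cong ∣_∣ eq
  ... | inj₂ eq = trans (cong ∣_∣ eq) (∣-i∣≡∣i∣ (cassini 0))

  d'Ocagne : ∀ k m → seqᶻ (suc (k + suc m)) *ᶻ seqᶻ m -ᶻ seqᶻ (suc m) *ᶻ seqᶻ (k + suc m)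
                   ≡ + fib (suc k) *ᶻ cassini m
  d'Ocagne k m = begin
    seqᶻ (suc (k + suc m)) *ᶻ seqᶻ m -ᶻ seqᶻ (suc m) *ᶻ seqᶻ (k + suc m)
      ≡⟨ cong (λ i → seqᶻ i *ᶻ seqᶻ m -ᶻ seqᶻ (suc m) *ᶻ seqᶻ (k + suc m)) (sym (+-suc k (suc m))) ⟩
    seqᶻ (k + suc (suc m)) *ᶻ seqᶻ m -ᶻ seqᶻ (suc m) *ᶻ seqᶻ (k + suc m)
      ≡⟨ cong₂ (λ s t → s *ᶻ seqᶻ m -ᶻ seqᶻ (suc m) *ᶻ t) (seqᶻ-+ k (suc m)) (seqᶻ-+ k m) ⟩
    (f₁ *ᶻ seqᶻ (suc (suc m)) +ᶻ f₀ *ᶻ seqᶻ (suc m)) *ᶻ seqᶻ m -ᶻ seqᶻ (suc m) *ᶻ (f₁ *ᶻ seqᶻ (suc m) +ᶻ f₀ *ᶻ seqᶻ m)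
      ≡⟨ identity f₁ f₀ (seqᶻ m) (seqᶻ (suc m)) (seqᶻ (suc (suc m))) ⟩
    f₁ *ᶻ cassini m ∎
    where
    open ≡-Reasoning
    f₁ f₀ : ℤ
    f₁ = + fib (suc k)
    f₀ = + fib k
    identity : ∀ f₁ f₀ v u w → (f₁ *ᶻ w +ᶻ f₀ *ᶻ u) *ᶻ v -ᶻ u *ᶻ (f₁ *ᶻ u +ᶻ f₀ *ᶻ v) ≡ f₁ *ᶻ (v *ᶻ w -ᶻ u *ᶻ u)
    identity = ℤ-Ring.solve-∀

%≡%⇒∣- : ∀ {p} .{{_ : NonZero p}} x y → x % p ≡ y % p → + p ∣ᶻ + x -ᶻ + y
%≡%⇒∣- {p} x y x≡y = divides (+ (x / p) -ᶻ + (y / p)) (begin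
  + x -ᶻ + y                                  ≡⟨ cong₂ _-ᶻ_ (split x) (split y) ⟩
  (r +ᶻ s *ᶻ + p) -ᶻ (+ (y % p) +ᶻ t *ᶻ + p) ≡⟨ cong (λ y% → (r +ᶻ s *ᶻ + p) -ᶻ (+ y% +ᶻ t *ᶻ + p)) (sym x≡y) ⟩
  (r +ᶻ s *ᶻ + p) -ᶻ (r +ᶻ t *ᶻ + p)         ≡⟨ identity r s t (+ p) ⟩
  (s -ᶻ t) *ᶻ + p                             ∎)
  where
  open ≡-Reasoning
  r s t : ℤ
  r = + (x % p)
  s = + (x / p)
  t = + (y / p)
  split : ∀ z → + z ≡ + (z % p) +ᶻ + (z / p) *ᶻ + p
  split z = trans (cong +_ (m≡m%n+[m/n]*n z p)) (trans (pos-+ (z % p) _) (cong (+ (z % p) +ᶻ_) (pos-* (z / p) p)))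
  identity : ∀ r s t q → (r +ᶻ s *ᶻ q) -ᶻ (r +ᶻ t *ᶻ q) ≡ (s -ᶻ t) *ᶻ q
  identity = ℤ-Ring.solve-∀

small⇒∤ : ∀ {p z} → 0 < ∣ z ∣ → ∣ z ∣ < p → ¬ (+ p ∣ᶻ z)
small⇒∤ {z = z} 0<∣z∣ ∣z∣<p p∣z with ∣ z ∣ | ∣⇒∣ᵤ p∣z
... | suc _ | p∣ᵤz = >⇒∤ ∣z∣<p p∣ᵤz

∣m*n∧∤n⇒∣m : ∀ {p} → Prime p → ∀ m n → + p ∣ᶻ m *ᶻ n → ¬ (+ p ∣ᶻ n) → + p ∣ᶻ m
∣m*n∧∤n⇒∣m p-prime m n p∣mn p∤n with euclidsLemma ∣ m ∣ ∣ n ∣ p-prime (subst (_ ℕ∣.∣_) (abs-* m n) (∣⇒∣ᵤ p∣mn))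
... | inj₁ p∣m = ∣ᵤ⇒∣ p∣m
... | inj₂ p∣n = ⊥-elim (p∤n (∣ᵤ⇒∣ p∣n))

∣-cross : ∀ {d} α β u v u′ v′ → d ∣ᶻ α *ᶻ u +ᶻ β *ᶻ v → d ∣ᶻ α *ᶻ u′ +ᶻ β *ᶻ v′ →
          d ∣ᶻ β *ᶻ (u′ *ᶻ v -ᶻ u *ᶻ v′)
∣-cross α β u v u′ v′ d∣αu+βv d∣αu′+βv′ =
  subst (_ ∣ᶻ_) (identity α β u v u′ v′) (∣m∣n⇒∣m-n (∣n⇒∣m*n u′ d∣αu+βv) (∣n⇒∣m*n u d∣αu′+βv′))
  where
  identity : ∀ α β u v u′ v′ → u′ *ᶻ (α *ᶻ u +ᶻ β *ᶻ v) -ᶻ u *ᶻ (α *ᶻ u′ +ᶻ β *ᶻ v′) ≡ β *ᶻ (u′ *ᶻ v -ᶻ u *ᶻ v′)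
  identity = ℤ-Ring.solve-∀

suc[m]∣n! : ∀ {m n} → suc m ≤ n → suc m ℕ∣.∣ n !
suc[m]∣n! {m} m<n = ∣-trans (m∣m*n (m !)) (m≤n⇒m!∣n! m<n)

prime∣suc[n!]⇒n<p : ∀ {p n} → Prime p → p ℕ∣.∣ suc (n !) → n < p
prime∣suc[n!]⇒n<p {zero}      p-prime _ = ⊥-elim (¬prime[0] p-prime)
prime∣suc[n!]⇒n<p {suc p} {n} p-prime p∣n!+1 with suc p ≤? n
... | no  p≰n = ≰⇒> p≰n
... | yes p≤n = ⊥-elim (¬prime[1] (subst Prime (∣1⇒≡1 (∣m+n∣m⇒∣n (subst (suc p ℕ∣.∣_) (+-comm 1 (n !)) p∣n!+1) (suc[m]∣n! p≤n))) p-prime))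

∃prime> : ∀ n → ∃[ p ] Prime p × n < p
∃prime> n = primeFactorOf (factorise (suc (n !)))
  where
  primeFactorOf : PrimeFactorisation (suc (n !)) → ∃[ p ] Prime p × n < p
  primeFactorOf record { factors = [] ; isFactorisation = n!+1≡1 } =
    ⊥-elim (≢-nonZero⁻¹ (n !) {{n !≢0}} (suc-injective n!+1≡1))
  primeFactorOf record { factors = p ∷ ps ; isFactorisation = n!+1≡p*ps ; factorsPrime = p-prime ∷ _ } =
    p , p-prime , prime∣suc[n!]⇒n<p p-prime (divides (product ps) (trans n!+1≡p*ps (*-comm p (product ps))))

digitsAux-< : ∀ p .{{_ : NonZero p}} fuel n → n < p → digitsAux p fuel n ≡ n % p ∷ []
digitsAux-< p zero       n _   = refl
digitsAux-< p (suc fuel) n n<p with n / p | m<n⇒m/n≡0 n<p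
... | .0 | refl = refl

digitsAux-≥ : ∀ p .{{_ : NonZero p}} fuel n → 0 < n / p → digitsAux p (suc fuel) n ≡ n % p ∷ digitsAux p fuel (n / p)
digitsAux-≥ p fuel n 0<n/p with n / p
... | suc _ = refl

digits[p+k] : ∀ {p k} .{{_ : NonZero p}} → 1 < p → k < p → digits p (p + k) ≡ k ∷ 1 ∷ []
digits[p+k] {p@(suc (suc q))} {k} (s≤s (s≤s z≤n)) k<p = begin
  digitsAux p (suc f) (p + k)               ≡⟨ digitsAux-≥ p f (p + k) (subst (0 <_) (sym [p+k]/p≡1) (s≤s z≤n)) ⟩
  (p + k) % p ∷ digitsAux p f ((p + k) / p) ≡⟨ cong (λ d → (p + k) % p ∷ digitsAux p f d) [p+k]/p≡1 ⟩
  (p + k) % p ∷ digitsAux p f 1             ≡⟨ cong₂ _∷_ [p+k]%p≡k (digitsAux-< p f 1 (s≤s (s≤s z≤n))) ⟩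
  k ∷ 1 % p ∷ []                            ≡⟨ cong (λ d → k ∷ d ∷ []) (m<n⇒m%n≡m (s≤s (s≤s z≤n))) ⟩
  k ∷ 1 ∷ []                                ∎
  where
  open ≡-Reasoning
  f : ℕ
  f = suc (q + k)
  [p+k]%p≡k : (p + k) % p ≡ k
  [p+k]%p≡k = trans (cong (_% p) (+-comm p k)) (trans ([m+n]%n≡m%n k p) (m<n⇒m%n≡m k<p))
  [p+k]/p≡1 : (p + k) / p ≡ 1
  [p+k]/p≡1 = trans (+-distrib-/-∣ˡ k (ℕ∣.∣-refl {p})) (cong₂ _+_ (n/n≡1 p) (m<n⇒m/n≡0 k<p))

IsLP⇒∣[p+k] : ∀ {S} → IsLP S → ∀ {p k} → Prime p → k < p → + p ∣ᶻ + S (p + k) -ᶻ + S k *ᶻ + S 1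
IsLP⇒∣[p+k] {S} S-LP {zero}            p-prime _   = ⊥-elim (¬prime[0] p-prime)
IsLP⇒∣[p+k] {S} S-LP {suc zero}        p-prime _   = ⊥-elim (¬prime[1] p-prime)
IsLP⇒∣[p+k] {S} S-LP {p@(suc (suc _))} {k} p-prime k<p =
  subst (+ p ∣ᶻ_) (cong (λ t → + S (p + k) -ᶻ t) (pos-* (S k) (S 1)))
    (%≡%⇒∣- (S (p + k)) (S k * S 1) (begin
    S (p + k) % p                          ≡⟨ S-LP p p-prime (p + k) ⟩
    product (map S (digits p (p + k))) % p ≡⟨ cong (λ ds → product (map S ds) % p) (digits[p+k] (s≤s (s≤s z≤n)) k<p) ⟩
    S k * (S 1 * 1) % p                    ≡⟨ cong (λ s → S k * s % p) (*-identityʳ (S 1)) ⟩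
    S k * S 1 % p                          ∎))
  where open ≡-Reasoning

module Fibonacci = FibonacciLikeProperties fibonacciSequence

∣fib⇒∤fib[1+]-c : ∀ {p c} X → 2 ≤ c → suc (c * c) < p → + p ∣ᶻ + fib X → ¬ (+ p ∣ᶻ + fib (suc X) -ᶻ + c)
∣fib⇒∤fib[1+]-c {p} {c} X (s≤s (s≤s z≤n)) c²+1<p p∣A p∣B-c = Q+c²-small (Fibonacci.cassini-± X) p∣Q+c²
  where
  A B : ℤ
  A = + fib X
  B = + fib (suc X)
  identity : ∀ A F₂ B c → A *ᶻ F₂ -ᶻ (B -ᶻ c) *ᶻ (B +ᶻ c) ≡ (A *ᶻ F₂ -ᶻ B *ᶻ B) +ᶻ c *ᶻ c
  identity = ℤ-Ring.solve-∀
  p∣Q+c² : + p ∣ᶻ Fibonacci.cassini X +ᶻ + (c * c)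
  p∣Q+c² = subst (+ p ∣ᶻ_) (trans (identity A _ B (+ c)) (cong (Fibonacci.cassini X +ᶻ_) (sym (pos-* c c))))
             (∣m∣n⇒∣m-n (∣m⇒∣m*n (+ fib (suc (suc X))) p∣A) (∣m⇒∣m*n (B +ᶻ + c) p∣B-c))
  Q+c²-small : ∀ {Q} → Q ≡ -[1+ 0 ] ⊎ Q ≡ + 1 → ¬ (+ p ∣ᶻ Q +ᶻ + (c * c))
  Q+c²-small (inj₁ refl) = small⇒∤ (s≤s z≤n) (≤-<-trans pred[n]≤n (<-trans (n<1+n (c * c)) c²+1<p))
  Q+c²-small (inj₂ refl) = small⇒∤ (s≤s z≤n) c²+1<p

module AffineSubsequence (G : FibonacciLike) (a b : ℕ) where
  open FibonacciLike G
  open FibonacciLikeProperties G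

  S : ℕ → ℕ
  S n = seq (suc a * n + suc b)

  c : ℕ
  c = S 1

  m₁ : ℕ
  m₁ = a + suc b

  module AtPrime (S-LP : IsLP S) {p} (p-prime : Prime p) where
    X : ℕ
    X = suc a * p

    A B : ℤ
    A = + fib X
    B = + fib (suc X)

    1<p : 1 < p
    1<p = nonTrivial⇒n>1 p {{prime⇒nonTrivial p-prime}}

    ∣shifted : ∀ k m → suc a * k + b ≡ m → k < p → + p ∣ᶻ (B -ᶻ + c) *ᶻ seqᶻ (suc m) +ᶻ A *ᶻ seqᶻ m
    ∣shifted k m refl k<p = subst (+ p ∣ᶻ_) S[p+k]-S[k]S[1] (IsLP⇒∣[p+k] S-LP p-prime k<p)
      where
      open ≡-Reasoning
      index : ∀ a p k b → suc a * (p + k) + suc b ≡ suc a * p + suc (suc a * k + b)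
      index = ℕ-Ring.solve-∀
      identity : ∀ B A c u v → (B *ᶻ u +ᶻ A *ᶻ v) -ᶻ u *ᶻ c ≡ (B -ᶻ c) *ᶻ u +ᶻ A *ᶻ v
      identity = ℤ-Ring.solve-∀
      S[p+k]-S[k]S[1] : + S (p + k) -ᶻ + S k *ᶻ + c ≡ (B -ᶻ + c) *ᶻ seqᶻ (suc m) +ᶻ A *ᶻ seqᶻ m
      S[p+k]-S[k]S[1] = begin
        seqᶻ (suc a * (p + k) + suc b) -ᶻ seqᶻ (suc a * k + suc b) *ᶻ + c
          ≡⟨ cong₂ (λ i j → seqᶻ i -ᶻ seqᶻ j *ᶻ + c) (index a p k b) (+-suc (suc a * k) b) ⟩
        seqᶻ (X + suc m) -ᶻ seqᶻ (suc m) *ᶻ + c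
          ≡⟨ cong (λ s → s -ᶻ seqᶻ (suc m) *ᶻ + c) (seqᶻ-+ X m) ⟩
        (B *ᶻ seqᶻ (suc m) +ᶻ A *ᶻ seqᶻ m) -ᶻ seqᶻ (suc m) *ᶻ + c
          ≡⟨ identity B A (+ c) (seqᶻ (suc m)) (seqᶻ m) ⟩
        (B -ᶻ + c) *ᶻ seqᶻ (suc m) +ᶻ A *ᶻ seqᶻ m ∎

    ∣shifted₀ : + p ∣ᶻ (B -ᶻ + c) *ᶻ seqᶻ (suc b) +ᶻ A *ᶻ seqᶻ b
    ∣shifted₀ = ∣shifted 0 b (cong (_+ b) (*-zeroʳ (suc a))) (<-trans (s≤s z≤n) 1<p)

    ∣shifted₁ : + p ∣ᶻ (B -ᶻ + c) *ᶻ seqᶻ (suc m₁) +ᶻ A *ᶻ seqᶻ m₁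
    ∣shifted₁ = ∣shifted 1 m₁ (trans (cong (_+ b) (*-identityʳ (suc a))) (sym (+-suc a b))) 1<p

    ∣A*fib[1+a]*cassini[b] : + p ∣ᶻ A *ᶻ (+ fib (suc a) *ᶻ cassini b)
    ∣A*fib[1+a]*cassini[b] = subst (λ D → + p ∣ᶻ A *ᶻ D) (d'Ocagne a b) (∣-cross (B -ᶻ + c) A _ _ _ _ ∣shifted₀ ∣shifted₁)

  ¬IsLP : 0 < ∣ cassini 0 ∣ → 0 < seq 1 → 2 ≤ c → ¬ IsLP S
  ¬IsLP 0<∣Q∣ 0<seq[1] 2≤c S-LP = noPrimeAbove (∃prime> bound)
    where
    f₁Q bound : ℕ
    f₁Q   = fib (suc a) * ∣ cassini 0 ∣
    bound = f₁Q + seq (suc m₁) + suc (c * c)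

    -- A prime above bound cannot divide any of the nonzero quantities f₁Q, seq (suc m₁), c² ± 1.
    noPrimeAbove : ¬ (∃[ p ] Prime p × bound < p)
    noPrimeAbove (p , p-prime , bound<p) = ∣fib⇒∤fib[1+]-c X 2≤c c²+1<p p∣A p∣B-c
      where
      open AtPrime S-LP p-prime
      ∣f₁Q∣ : ∣ + fib (suc a) *ᶻ cassini b ∣ ≡ f₁Q
      ∣f₁Q∣ = trans (abs-* (+ fib (suc a)) (cassini b)) (cong (fib (suc a) *_) (∣cassini∣ b))
      p∣A : + p ∣ᶻ A
      p∣A = ∣m*n∧∤n⇒∣m p-prime A _ ∣A*fib[1+a]*cassini[b] (small⇒∤
              (subst (0 <_) (sym ∣f₁Q∣) (*-mono-< (Fibonacci.0<seq[1+n] (s≤s z≤n) a) 0<∣Q∣))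
              (subst (_< p) (sym ∣f₁Q∣) (≤-<-trans (≤-trans (m≤m+n f₁Q _) (m≤m+n _ _)) bound<p)))
      p∣B-c : + p ∣ᶻ B -ᶻ + c
      p∣B-c = ∣m*n∧∤n⇒∣m p-prime (B -ᶻ + c) (seqᶻ (suc m₁)) (∣m+n∣n⇒∣m ∣shifted₁ (∣m⇒∣m*n (seqᶻ m₁) p∣A)) (small⇒∤
                (0<seq[1+n] 0<seq[1] m₁)
                (≤-<-trans (≤-trans (m≤n+m (seq (suc m₁)) f₁Q) (m≤m+n _ _)) bound<p))
      c²+1<p : suc (c * c) < p
      c²+1<p = ≤-<-trans (m≤n+m (suc (c * c)) (f₁Q + seq (suc m₁))) bound<p

module Lucas = FibonacciLikeProperties lucasSequence

2≤fib[3+n] : ∀ n → 2 ≤ fib (3 + n)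
2≤fib[3+n] n = Fibonacci.2≤seq[2+n] (suc n) (Fibonacci.0<seq[1+n] (s≤s z≤n) n) (Fibonacci.0<seq[1+n] (s≤s z≤n) (suc n))

0<lucas : ∀ n → 0 < lucas n
0<lucas zero    = s≤s z≤n
0<lucas (suc n) = Lucas.0<seq[1+n] (s≤s z≤n) n

¬IsLP-fib : ∀ a b → ¬ IsLP (λ n → fib (suc a * n + suc b))
-- Here S 1 = F₂ = 1, outside the general argument; the prime 2 refutes the Lucas property at n = 2.
¬IsLP-fib zero zero S-LP with S-LP 2 prime[2] 2
... | ()
¬IsLP-fib zero (suc b) = AffineSubsequence.¬IsLP fibonacciSequence zero (suc b) (s≤s z≤n) (s≤s z≤n) (2≤fib[3+n] b)
¬IsLP-fib (suc a) b = AffineSubsequence.¬IsLP fibonacciSequence (suc a) b (s≤s z≤n) (s≤s z≤n)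
  (subst (λ i → 2 ≤ fib i) (sym (index a b)) (2≤fib[3+n] (a + b)))
  where
  index : ∀ a b → suc (suc a) * 1 + suc b ≡ 3 + (a + b)
  index = ℕ-Ring.solve-∀

¬IsLP-lucas : ∀ a b → ¬ IsLP (λ n → lucas (suc a * n + suc b))
¬IsLP-lucas a b = AffineSubsequence.¬IsLP lucasSequence a b (s≤s z≤n) (s≤s z≤n)
  (subst (λ i → 2 ≤ lucas i) (sym (index a b)) (Lucas.2≤seq[2+n] (a + b) (0<lucas (a + b)) (0<lucas (suc (a + b)))))
  where
  index : ∀ a b → suc a * 1 + suc b ≡ 2 + (a + b)
  index = ℕ-Ring.solve-∀

corollary1 : ∀ (a b : ℕ) →
    ¬ IsLP (λ n → fib (suc a * n + suc b)) × ¬ IsLP (λ n → lucas (suc a * n + suc b))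
corollary1 a b = ¬IsLP-fib a b , ¬IsLP-lucas a b
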